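{- Let $n$ and $p$ be integers with $\frac{n}{2}<p<n-2$, and let $t=2(p+1)-n$. Let $G=G_n^t$ be the graph obtained as follows: partition the vertex set of the complete graph $K_n$ into $n-p$ classes $V_1,\ldots,V_{n-p}$ with $|V_1|=\cdots=|V_{n-p-1}|=2$ and $|V_{n-p}|=t$; for each $j\in\{1,\ldots,n-p\}$ select a vertex $v_j^*\in V_j$ and delete all edges joining $v_j^*$ to the other vertices of $V_j$. Then $tmc(G)=m$, where $m=|E(G)|$.
   Context: All graphs are finite, simple and undirected. A graph is total-colored if all its edges and all its vertices are assigned colors. A path in a total-colored graph is a total monochromatic path if all its edges and all its internal vertices have the same color. A total-coloring of a connected graph $G$ is a TMC-coloring if any two vertices of $G$ are joined by a total monochromatic path. The total monochromatic connection number $tmc(G)$ of a connected graph $G$ is the maximum number of colors used in a TMC-coloring of $G$. -}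

module Defs where

open import Data.Nat using (ℕ; zero; suc; _+_; _*_; _∸_; _<ᵇ_; _≡ᵇ_)
open import Data.Nat.DivMod using (_/_; _%_)
open import Data.Bool using (Bool; true; false; T; _∧_; _∨_; not; if_then_else_)
open import Data.Fin using (Fin; toℕ)
open import Data.List using (List; []; _∷_; _++_; map; allFin)
open import Data.Nat.ListAction using (sum)
open import Data.List.Relation.Unary.All using (All)
open import Data.List.Relation.Unary.Linked using (Linked)
open import Data.List.Relation.Unary.Unique.Propositional using (Unique)
open import Data.Product using (Σ; _×_; ∃; ∃-syntax)
open import Data.Sum using (_⊎_)
open import Relation.Binary.PropositionalEquality using (_≡_; _≢_)

-- Graphs on vertex set Fin n, given by a Boolean adjacency function
-- (intended to be symmetric and irreflexive: a finite simple graph).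

Graph : ℕ → Set
Graph n = Fin n → Fin n → Bool

Adj : ∀ {n} → Graph n → Fin n → Fin n → Set
Adj G u v = T (G u v)

edgeCount : ∀ {n} → Graph n → ℕ
edgeCount {n} G =
  sum (map (λ u → sum (map (λ v → if (toℕ u <ᵇ toℕ v) ∧ G u v then 1 else 0)
                          (allFin n)))
           (allFin n))

record TotalColoring {n : ℕ} (G : Graph n) (k : ℕ) : Set where
  field
    vcol : Fin n → Fin k
    ecol : Fin n → Fin n → Fin k
    ecol-sym : ∀ u v → Adj G u v → ecol u v ≡ ecol v u

open TotalColoring public

UsesAllColors : ∀ {n k} {G : Graph n} → TotalColoring G k → Set
UsesAllColors {n} {k} {G} c =
  (col : Fin k) →
    (∃[ v ] vcol c v ≡ col) ⊎ (∃[ u ] ∃[ v ] (Adj G u v × ecol c u v ≡ col))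

TMPath : ∀ {n k} {G : Graph n} → TotalColoring G k →
         Fin k → Fin n → List (Fin n) → Fin n → Set
TMPath {G = G} c col u ws v =
  Unique (u ∷ ws ++ v ∷ []) ×
  Linked (λ x y → Adj G x y × ecol c x y ≡ col) (u ∷ ws ++ v ∷ []) ×
  All (λ w → vcol c w ≡ col) ws

IsTMC : ∀ {n k} {G : Graph n} → TotalColoring G k → Set
IsTMC {n} {k} c =
  (u v : Fin n) → u ≢ v → ∃[ col ] ∃[ ws ] TMPath c col u ws v

TmcEq : ∀ {n} → Graph n → ℕ → Set
TmcEq G m =
  (Σ (TotalColoring G m) λ c → IsTMC c × UsesAllColors c) ×
  ((k : ℕ) (c : TotalColoring G k) → IsTMC c → UsesAllColors c → k Data.Nat.≤ m)

-- Vertices 0..n-1; q = n-p-1 classes of size 2: V_j = {2j, 2j+1}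
-- (j < q), last class V_q = {2q, ..., n-1} of size t.
-- Selected vertex of each class: its smallest element.

module _ (n p : ℕ) where
  private
    q : ℕ
    q = n ∸ p ∸ 1

  vclass : ℕ → ℕ
  vclass i = if i <ᵇ 2 * q then i / 2 else q

  selected : ℕ → Bool
  selected i = if i <ᵇ 2 * q then i % 2 ≡ᵇ 0 else i ≡ᵇ 2 * q

  Gnt : Graph n
  Gnt u v =
    let i = toℕ u ; j = toℕ v in
    not (i ≡ᵇ j) ∧ not ((vclass i ≡ᵇ vclass j) ∧ (selected i ∨ selected j))

-- Upper bound: in a graph without a dominating vertex, the colours of a TMC-colouring
-- inject into its edges. A colour carried by a vertex u goes to the first edge uw of a
-- monochromatic path from u to a non-neighbour; this edge has the colour of the vertex
-- w. So no colour missing from the vertices goes to such an edge, and if the colours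
-- of u and u' go to the same edge uu', both equal the colour of that edge. A colour
-- carried by no vertex goes to any edge carrying it.
--
-- Lower bound: in G_n^t let s be the selected vertex of the last class, w another
-- vertex of that class and z a vertex of the first class. Then w is adjacent to every
-- vertex but s, and s is adjacent to z. Colour zw, sz and all edges at w red and every
-- other edge with its own colour; colour z and w red, s with the old colour of sz and
-- every other vertex x with the old colour of xw. All m colours are used, and every
-- non-adjacent pair is joined by a red path through w, or through z and w.

module Submission where

open import Defs
open import Data.Nat using (ℕ; _<_; _+_; _*_)

open import Data.Bool using (Bool; true; false; T; _∧_; _∨_; if_then_else_)
open import Data.Bool.Properties using (T?; T-≡; T-not-≡; T-∧; T-∨; ∧-zeroʳ; ∨-comm)
open import Data.Empty using (⊥-elim)
open import Data.Fin as Fin using (Fin; toℕ; fromℕ<)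
open import Data.Fin.Properties as Fin
  using (toℕ-injective; toℕ-fromℕ<; injective⇒≤; any?; <-cmp)
open import Data.List using (List; []; _∷_; _++_; map; filter; cartesianProduct; allFin; length; lookup)
open import Data.List.Properties using (map-++; map-∘)
open import Data.List.Membership.Propositional using (_∈_)
open import Data.List.Membership.Propositional.Properties
  using (∈-filter⁺; ∈-filter⁻; ∈-cartesianProduct⁺; ∈-allFin; ∈-lookup)
open import Data.List.Membership.Setoid.Properties using (index-injective)
open import Data.List.Relation.Unary.All as All using ([]; _∷_)
open import Data.List.Relation.Unary.Any using (index)
open import Data.List.Relation.Unary.Any.Properties using (lookup-index)
open import Data.List.Relation.Unary.AllPairs using ([]; _∷_)
open import Data.List.Relation.Unary.Linked using ([-]; _∷_)
open import Data.List.Relation.Unary.Unique.Propositional using (Unique)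
open import Data.List.Relation.Unary.Unique.Propositional.Properties
  using (filter⁺; cartesianProduct⁺; allFin⁺)
open import Data.Nat as ℕ using (zero; suc; _∸_; _≤_; _<ᵇ_; _≡ᵇ_; z≤n; s≤s)
open import Data.Nat.DivMod
  using (_/_; _%_; m≡m%n+[m/n]*n; m%n<n; m*n/n≡m; m*n%n≡0; +-distrib-/-∣ʳ; m<n*o⇒m/o<n)
open import Data.Nat.Divisibility using (divides)
open import Data.Nat.ListAction using (sum)
open import Data.Nat.ListAction.Properties using (sum-++)
open import Data.Nat.Properties as ℕ
  using (≡⇒≡ᵇ; <⇒<ᵇ; <ᵇ⇒<; <⇒≤; +-suc; +-comm; +-identityʳ; *-comm; ∸-+-assoc; m∸n+n≡m;
         +-cancelʳ-≤; +-cancelʳ-<; +-monoʳ-≤; *-monoˡ-≤; n<1+n; <-trans; module ≤-Reasoning)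
open import Data.Product using (Σ; _×_; _,_; proj₁; proj₂; ∃-syntax; swap; uncurry)
open import Data.Product.Properties using (,-injective; ≡-dec)
open import Data.Sum as Sum using (_⊎_; inj₁; inj₂)
open import Function using (_∘_)
open import Function.Bundles using (Equivalence)
open import Relation.Binary.PropositionalEquality
open import Relation.Binary.Definitions using (tri<; tri≈; tri>)
open import Relation.Nullary using (¬_; Dec; does; yes; no; contradiction)
open import Relation.Nullary.Decidable using (dec-true; dec-false; _⊎-dec_)
open import Relation.Unary using (Decidable)

lookup-injective : ∀ {A : Set} {xs : List A} → Unique xs →
                   ∀ {i j} → lookup xs i ≡ lookup xs j → i ≡ j
lookup-injective (_  ∷ _) {Fin.zero}  {Fin.zero}  _  = refl
lookup-injective (x∉ ∷ _) {Fin.zero}  {Fin.suc j} eq = ⊥-elim (All.lookup x∉ (∈-lookup j) eq)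
lookup-injective (x∉ ∷ _) {Fin.suc i} {Fin.zero}  eq = ⊥-elim (All.lookup x∉ (∈-lookup i) (sym eq))
lookup-injective (_  ∷ u) {Fin.suc i} {Fin.suc j} eq = cong Fin.suc (lookup-injective u eq)

length-filter : ∀ {A : Set} {P : A → Set} (P? : Decidable P) (xs : List A) →
                length (filter P? xs) ≡ sum (map (λ x → if does (P? x) then 1 else 0) xs)
length-filter P? [] = refl
length-filter P? (x ∷ xs) with does (P? x)
... | true  = cong suc (length-filter P? xs)
... | false = length-filter P? xs

sum-cartesianProduct : ∀ {A B : Set} (f : A × B → ℕ) (xs : List A) (ys : List B) →
  sum (map f (cartesianProduct xs ys)) ≡ sum (map (λ x → sum (map (λ y → f (x , y)) ys)) xs)
sum-cartesianProduct f [] ys = refl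
sum-cartesianProduct f (x ∷ xs) ys = begin
  sum (map f (map (x ,_) ys ++ cartesianProduct xs ys))
    ≡⟨ cong sum (map-++ f (map (x ,_) ys) _) ⟩
  sum (map f (map (x ,_) ys) ++ map f (cartesianProduct xs ys))
    ≡⟨ sum-++ (map f (map (x ,_) ys)) _ ⟩
  sum (map f (map (x ,_) ys)) + sum (map f (cartesianProduct xs ys))
    ≡⟨ cong₂ _+_ (cong sum (sym (map-∘ ys))) (sum-cartesianProduct f xs ys) ⟩
  sum (map (λ y → f (x , y)) ys) + sum (map (λ x → sum (map (λ y → f (x , y)) ys)) xs) ∎
  where open ≡-Reasoning

≡ᵇ-refl : ∀ i → (i ≡ᵇ i) ≡ true
≡ᵇ-refl zero    = refl
≡ᵇ-refl (suc i) = ≡ᵇ-refl i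

≡ᵇ-sym : ∀ i j → (i ≡ᵇ j) ≡ (j ≡ᵇ i)
≡ᵇ-sym zero    zero    = refl
≡ᵇ-sym zero    (suc j) = refl
≡ᵇ-sym (suc i) zero    = refl
≡ᵇ-sym (suc i) (suc j) = ≡ᵇ-sym i j

≢⇒≡ᵇ≡false : ∀ {i j} → i ≢ j → (i ≡ᵇ j) ≡ false
≢⇒≡ᵇ≡false {i} {j} = dec-false (i ℕ.≟ j)

<⇒<ᵇ≡true : ∀ {i j} → i < j → (i <ᵇ j) ≡ true
<⇒<ᵇ≡true {i} {j} = dec-true (i ℕ.<? j)

≮⇒<ᵇ≡false : ∀ {i j} → ¬ i < j → (i <ᵇ j) ≡ false
≮⇒<ᵇ≡false {i} {j} = dec-false (i ℕ.<? j)

orient : ∀ {n} → Fin n → Fin n → Fin n × Fin n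
orient u v with u Fin.<? v
... | yes _ = u , v
... | no  _ = v , u

orient-< : ∀ {n} {u v : Fin n} → u Fin.< v → orient u v ≡ (u , v)
orient-< {u = u} {v} u<v with u Fin.<? v
... | yes _   = refl
... | no  u≮v = contradiction u<v u≮v

orient-> : ∀ {n} {u v : Fin n} → v Fin.< u → orient u v ≡ (v , u)
orient-> {u = u} {v} v<u with u Fin.<? v
... | yes u<v = contradiction u<v (Fin.<-asym v<u)
... | no  _   = refl

orient-comm : ∀ {n} {u v : Fin n} → u ≢ v → orient u v ≡ orient v u
orient-comm {u = u} {v} u≢v with <-cmp u v
... | tri< u<v _ _ = trans (orient-< u<v) (sym (orient-> u<v))
... | tri≈ _ u≡v _ = contradiction u≡v u≢v
... | tri> _ _ v<u = trans (orient-> v<u) (sym (orient-< v<u))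

orient-injective : ∀ {n} {u v u′ v′ : Fin n} → orient u v ≡ orient u′ v′ →
                   (u ≡ u′ × v ≡ v′) ⊎ (u ≡ v′ × v ≡ u′)
orient-injective {u = u} {v} {u′} {v′} eq with u Fin.<? v | u′ Fin.<? v′
... | yes _ | yes _ = inj₁ (,-injective eq)
... | yes _ | no  _ = inj₂ (,-injective eq)
... | no  _ | yes _ = inj₂ (swap (,-injective eq))
... | no  _ | no  _ = inj₁ (swap (,-injective eq))

module EdgeList {n : ℕ} (G : Graph n) where

  isEdge : Fin n × Fin n → Bool
  isEdge (a , b) = (toℕ a <ᵇ toℕ b) ∧ G a b

  pairs : List (Fin n × Fin n)
  pairs = cartesianProduct (allFin n) (allFin n)

  edges : List (Fin n × Fin n)
  edges = filter (T? ∘ isEdge) pairs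

  length-edges : length edges ≡ edgeCount G
  length-edges = trans (length-filter (T? ∘ isEdge) pairs) (sum-cartesianProduct _ (allFin n) (allFin n))

  edges-unique : Unique edges
  edges-unique = filter⁺ (T? ∘ isEdge) (cartesianProduct⁺ (allFin⁺ n) (allFin⁺ n))

  ∈-edges⁺ : ∀ {a b} → a Fin.< b → Adj G a b → (a , b) ∈ edges
  ∈-edges⁺ {a} {b} a<b ab = ∈-filter⁺ (T? ∘ isEdge)
    (∈-cartesianProduct⁺ (∈-allFin a) (∈-allFin b)) (Equivalence.from T-∧ (<⇒<ᵇ a<b , ab))

  ∈-edges⁻ : ∀ {a b} → (a , b) ∈ edges → a Fin.< b × Adj G a b
  ∈-edges⁻ {a} {b} ab∈ with Equivalence.to T-∧ (proj₂ (∈-filter⁻ (T? ∘ isEdge) {xs = pairs} ab∈))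
  ... | a<ᵇb , ab = <ᵇ⇒< (toℕ a) (toℕ b) a<ᵇb , ab

  orient-edge : ∀ {a b} → (a , b) ∈ edges → orient a b ≡ (a , b)
  orient-edge = orient-< ∘ proj₁ ∘ ∈-edges⁻

  orient-edge-swap : ∀ {a b} → (a , b) ∈ edges → orient b a ≡ (a , b)
  orient-edge-swap = orient-> ∘ proj₁ ∘ ∈-edges⁻

NoDominatingVertex : ∀ {n} → Graph n → Set
NoDominatingVertex {n} G = (u : Fin n) → ∃[ v ] (u ≢ v × ¬ Adj G u v)

module SimpleGraph {n : ℕ} (G : Graph n)
  (adj-sym : ∀ {u v} → Adj G u v → Adj G v u)
  (adj-irrefl : ∀ {u} → ¬ Adj G u u) where

  open EdgeList G

  adj⇒≢ : ∀ {u v} → Adj G u v → u ≢ v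
  adj⇒≢ uv refl = adj-irrefl uv

  orient∈edges : ∀ {u v} → Adj G u v → orient u v ∈ edges
  orient∈edges {u} {v} uv with <-cmp u v
  ... | tri< u<v _ _ = subst (_∈ edges) (sym (orient-< u<v)) (∈-edges⁺ u<v uv)
  ... | tri≈ _ u≡v _ = contradiction u≡v (adj⇒≢ uv)
  ... | tri> _ _ v<u = subst (_∈ edges) (sym (orient-> v<u)) (∈-edges⁺ v<u (adj-sym uv))

  module _ {k : ℕ} (c : TotalColoring G k) where

    pairColour : Fin n × Fin n → Fin k
    pairColour = uncurry (ecol c)

    pairColour-orient : ∀ {u v} → Adj G u v → pairColour (orient u v) ≡ ecol c u v
    pairColour-orient {u} {v} uv with u Fin.<? v
    ... | yes _ = refl
    ... | no  _ = sym (ecol-sym c u v uv)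

  module UpperBound {k : ℕ} (c : TotalColoring G k)
    (no-dom : NoDominatingVertex G) (tmc : IsTMC c) (all-used : UsesAllColors c) where

    step : ∀ u → ∃[ w ] (Adj G u w × ecol c u w ≡ vcol c w)
    step u with no-dom u
    ... | v , u≢v , u≁v with tmc u v u≢v
    ... | _ , []    , _ , (uv , _)      ∷ [-] , _         = contradiction uv u≁v
    ... | _ , x ∷ _ , _ , (ux , ux-col) ∷ _   , x-col ∷ _ = x , ux , trans ux-col (sym x-col)

    next : Fin n → Fin n
    next u = proj₁ (step u)

    next-adj : ∀ u → Adj G u (next u)
    next-adj u = proj₁ (proj₂ (step u))

    next-colour : ∀ u → pairColour c (orient u (next u)) ≡ vcol c (next u)
    next-colour u = trans (pairColour-orient c (next-adj u)) (proj₂ (proj₂ (step u)))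

    data Source (j : Fin k) : Set where
      vertex : ∀ u → vcol c u ≡ j → Source j
      edge   : ∀ {a b} → Adj G a b → ecol c a b ≡ j → (∀ v → vcol c v ≢ j) → Source j

    source : ∀ j → Source j
    source j with any? (λ v → vcol c v Fin.≟ j)
    ... | yes (u , u-col) = vertex u u-col
    ... | no  no-vertex with all-used j
    ...   | inj₁ coloured-vertex = contradiction coloured-vertex no-vertex
    ...   | inj₂ (_ , _ , ab , ab-col) = edge ab ab-col (λ v v-col → no-vertex (v , v-col))

    witness : ∀ {j} → Source j → Fin n × Fin n
    witness (vertex u _)         = orient u (next u)
    witness (edge {a} {b} _ _ _) = orient a b

    witness∈edges : ∀ {j} (σ : Source j) → witness σ ∈ edges
    witness∈edges (vertex u _)  = orient∈edges (next-adj u)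
    witness∈edges (edge ab _ _) = orient∈edges ab

    witness-injective : ∀ {i j} (σ : Source i) (τ : Source j) → witness σ ≡ witness τ → i ≡ j
    witness-injective (vertex u refl) (vertex u′ refl) eq with orient-injective eq
    ... | inj₁ (refl , _) = refl
    ... | inj₂ (u≡next-u′ , next-u≡u′) = begin
      vcol c u                           ≡⟨ cong (vcol c) u≡next-u′ ⟩
      vcol c (next u′)                   ≡⟨ sym (next-colour u′) ⟩
      pairColour c (orient u′ (next u′)) ≡⟨ cong (pairColour c) (sym eq) ⟩
      pairColour c (orient u (next u))   ≡⟨ next-colour u ⟩
      vcol c (next u)                    ≡⟨ cong (vcol c) next-u≡u′ ⟩
      vcol c u′                          ∎
      where open ≡-Reasoning
    witness-injective (vertex u refl) (edge ab refl no-vertex) eq = contradiction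
      (trans (sym (next-colour u)) (trans (cong (pairColour c) eq) (pairColour-orient c ab)))
      (no-vertex (next u))
    witness-injective (edge ab refl no-vertex) (vertex u refl) eq = contradiction
      (trans (sym (next-colour u)) (trans (cong (pairColour c) (sym eq)) (pairColour-orient c ab)))
      (no-vertex (next u))
    witness-injective (edge ab refl _) (edge a′b′ refl _) eq =
      trans (sym (pairColour-orient c ab)) (trans (cong (pairColour c) eq) (pairColour-orient c a′b′))

    colours≤edgeCount : k ≤ edgeCount G
    colours≤edgeCount = subst (k ≤_) length-edges (injective⇒≤ witness-index-injective)
      where
      witness-index : Fin k → Fin (length edges)
      witness-index j = index (witness∈edges (source j))

      witness-index-injective : ∀ {i j} → witness-index i ≡ witness-index j → i ≡ j
      witness-index-injective {i} {j} eq = witness-injective (source i) (source j)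
        (index-injective (setoid (Fin n × Fin n)) (witness∈edges (source i)) (witness∈edges (source j)) eq)

  module LowerBound (s z w : Fin n) (s≢w : s ≢ w) (s~z : Adj G s z) (s≁w : ¬ Adj G s w)
    (adj-w : ∀ {x} → x ≢ s → x ≢ w → Adj G x w) where

    _≟²_ : (e e′ : Fin n × Fin n) → Dec (e ≡ e′)
    _≟²_ = ≡-dec Fin._≟_ Fin._≟_

    open import Data.List.Membership.DecPropositional _≟²_ using (_∈?_)

    z≢s : z ≢ s
    z≢s z≡s = adj-irrefl (subst (Adj G s) z≡s s~z)

    z≢w : z ≢ w
    z≢w z≡w = s≁w (subst (Adj G s) z≡w s~z)

    z~w : Adj G z w
    z~w = adj-w z≢s z≢w

    m : ℕ
    m = length edges

    -- The value on non-edges is irrelevant; only m > 0 is needed to define it.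
    edgeIndex : Fin n × Fin n → Fin m
    edgeIndex e with e ∈? edges
    ... | yes e∈ = index e∈
    ... | no  _  = index (orient∈edges z~w)

    edgeIndex-lookup : ∀ i → edgeIndex (lookup edges i) ≡ i
    edgeIndex-lookup i with lookup edges i ∈? edges
    ... | yes e∈ = lookup-injective edges-unique (sym (lookup-index e∈))
    ... | no  e∉ = contradiction (∈-lookup i) e∉

    red : Fin m
    red = edgeIndex (orient z w)

    Red : Fin n × Fin n → Set
    Red (a , b) = a ≡ w ⊎ b ≡ w ⊎ (a , b) ≡ (z , s) ⊎ (a , b) ≡ (s , z)

    red? : ∀ e → Dec (Red e)
    red? (a , b) = a Fin.≟ w ⊎-dec b Fin.≟ w ⊎-dec (a , b) ≟² (z , s) ⊎-dec (a , b) ≟² (s , z)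

    Red-orient : ∀ {a b} → Red (a , b) → Red (b , a) → Red (orient a b)
    Red-orient {a} {b} ab ba with a Fin.<? b
    ... | yes _ = ab
    ... | no  _ = ba

    edgeColour : Fin n × Fin n → Fin m
    edgeColour e with red? e
    ... | yes _ = red
    ... | no  _ = edgeIndex e

    edgeColour-red : ∀ {e} → Red e → edgeColour e ≡ red
    edgeColour-red {e} r with red? e
    ... | yes _  = refl
    ... | no  ¬r = contradiction r ¬r

    edgeColour-other : ∀ {e} → ¬ Red e → edgeColour e ≡ edgeIndex e
    edgeColour-other {e} ¬r with red? e
    ... | yes r = contradiction r ¬r
    ... | no  _ = refl

    vertexColour : Fin n → Fin m
    vertexColour x with x Fin.≟ s | x Fin.≟ w
    ... | yes _ | _     = edgeIndex (orient s z)
    ... | no  _ | yes _ = red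
    ... | no  _ | no  _ = edgeIndex (orient x w)

    vertexColour-s : vertexColour s ≡ edgeIndex (orient s z)
    vertexColour-s with s Fin.≟ s
    ... | yes _   = refl
    ... | no  s≢s = contradiction refl s≢s

    vertexColour-w : vertexColour w ≡ red
    vertexColour-w with w Fin.≟ s | w Fin.≟ w
    ... | yes w≡s | _       = contradiction (sym w≡s) s≢w
    ... | no  _   | yes _   = refl
    ... | no  _   | no  w≢w = contradiction refl w≢w

    vertexColour-other : ∀ {x} → x ≢ s → x ≢ w → vertexColour x ≡ edgeIndex (orient x w)
    vertexColour-other {x} x≢s x≢w with x Fin.≟ s | x Fin.≟ w
    ... | yes x≡s | _       = contradiction x≡s x≢s
    ... | no  _   | yes x≡w = contradiction x≡w x≢w
    ... | no  _   | no  _   = refl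

    vertexColour-z : vertexColour z ≡ red
    vertexColour-z = vertexColour-other z≢s z≢w

    colouring : TotalColoring G m
    colouring = record
      { vcol     = vertexColour
      ; ecol     = λ u v → edgeColour (orient u v)
      ; ecol-sym = λ u v uv → cong edgeColour (orient-comm (adj⇒≢ uv))
      }

    ecol-red : ∀ u v → Red (u , v) → Red (v , u) → ecol colouring u v ≡ red
    ecol-red u v uv vu = edgeColour-red (Red-orient {u} {v} uv vu)

    ecol-·w : ∀ x → ecol colouring x w ≡ red
    ecol-·w x = ecol-red x w (inj₂ (inj₁ refl)) (inj₁ refl)

    ecol-w· : ∀ x → ecol colouring w x ≡ red
    ecol-w· x = ecol-red w x (inj₁ refl) (inj₂ (inj₁ refl))

    ecol-sz : ecol colouring s z ≡ red
    ecol-sz = ecol-red s z (inj₂ (inj₂ (inj₂ refl))) (inj₂ (inj₂ (inj₁ refl)))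

    ecol-zs : ecol colouring z s ≡ red
    ecol-zs = ecol-red z s (inj₂ (inj₂ (inj₁ refl))) (inj₂ (inj₂ (inj₂ refl)))

    adj-w⇒≢s : ∀ {x} → Adj G x w → x ≢ s
    adj-w⇒≢s xw refl = s≁w xw

    from-s : ∀ {v} → s ≢ v → ¬ Adj G s v → ∃[ ws ] TMPath colouring red s ws v
    from-s {v} s≢v s≁v with v Fin.≟ w
    ... | yes refl = z ∷ [] ,
      (≢-sym z≢s ∷ s≢w ∷ []) ∷ (z≢w ∷ []) ∷ [] ∷ [] ,
      (s~z , ecol-sz) ∷ (z~w , ecol-·w z) ∷ [-] ,
      vertexColour-z ∷ []
    ... | no v≢w = z ∷ w ∷ [] ,
      (≢-sym z≢s ∷ s≢w ∷ s≢v ∷ []) ∷ (z≢w ∷ z≢v ∷ []) ∷ (≢-sym v≢w ∷ []) ∷ [] ∷ [] ,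
      (s~z , ecol-sz) ∷ (z~w , ecol-·w z) ∷ (adj-sym (adj-w (≢-sym s≢v) v≢w) , ecol-w· v) ∷ [-] ,
      vertexColour-z ∷ vertexColour-w ∷ []
      where
      z≢v : z ≢ v
      z≢v refl = s≁v s~z

    to-s : ∀ {u} → u ≢ s → ¬ Adj G u s → ∃[ ws ] TMPath colouring red u ws s
    to-s {u} u≢s u≁s with u Fin.≟ w
    ... | yes refl = z ∷ [] ,
      (≢-sym z≢w ∷ ≢-sym s≢w ∷ []) ∷ (z≢s ∷ []) ∷ [] ∷ [] ,
      (adj-sym z~w , ecol-w· z) ∷ (adj-sym s~z , ecol-zs) ∷ [-] ,
      vertexColour-z ∷ []
    ... | no u≢w = w ∷ z ∷ [] ,
      (u≢w ∷ u≢z ∷ u≢s ∷ []) ∷ (≢-sym z≢w ∷ ≢-sym s≢w ∷ []) ∷ (z≢s ∷ []) ∷ [] ∷ [] ,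
      (adj-w u≢s u≢w , ecol-·w u) ∷ (adj-sym z~w , ecol-w· z) ∷ (adj-sym s~z , ecol-zs) ∷ [-] ,
      vertexColour-w ∷ vertexColour-z ∷ []
      where
      u≢z : u ≢ z
      u≢z refl = u≁s (adj-sym s~z)

    through-w : ∀ {u v} → u ≢ s → v ≢ s → u ≢ v → ¬ Adj G u v → TMPath colouring red u (w ∷ []) v
    through-w {u} {v} u≢s v≢s u≢v u≁v =
      (u≢w ∷ u≢v ∷ []) ∷ (w≢v ∷ []) ∷ [] ∷ [] ,
      (adj-w u≢s u≢w , ecol-·w u) ∷ (adj-sym (adj-w v≢s (≢-sym w≢v)) , ecol-w· v) ∷ [-] ,
      vertexColour-w ∷ []
      where
      u≢w : u ≢ w
      u≢w refl = u≁v (adj-sym (adj-w v≢s (≢-sym u≢v)))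
      w≢v : w ≢ v
      w≢v refl = u≁v (adj-w u≢s u≢v)

    tmc : IsTMC colouring
    tmc u v u≢v with T? (G u v)
    ... | yes uv = ecol colouring u v , [] , (u≢v ∷ []) ∷ [] ∷ [] , (uv , refl) ∷ [-] , []
    ... | no u≁v with u Fin.≟ s | v Fin.≟ s
    ...   | yes refl | _        = red , from-s u≢v u≁v
    ...   | no  u≢s  | yes refl = red , to-s u≢s u≁v
    ...   | no  u≢s  | no  v≢s  = red , w ∷ [] , through-w u≢s v≢s u≢v u≁v

    Used : Fin m → Set
    Used j = (∃[ x ] vertexColour x ≡ j) ⊎ (∃[ u ] ∃[ v ] (Adj G u v × ecol colouring u v ≡ j))

    edgeIndex-used : ∀ {e} → e ∈ edges → Used (edgeIndex e)
    edgeIndex-used {a , b} ab∈ with red? (a , b) | proj₂ (∈-edges⁻ ab∈)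
    ... | no ¬red                       | ab = inj₂ (a , b , ab ,
      trans (cong edgeColour (orient-edge ab∈)) (edgeColour-other ¬red))
    ... | yes (inj₁ refl)               | ab = inj₁ (b ,
      trans (vertexColour-other (adj-w⇒≢s (adj-sym ab)) (≢-sym (adj⇒≢ ab)))
            (cong edgeIndex (orient-edge-swap ab∈)))
    ... | yes (inj₂ (inj₁ refl))        | ab = inj₁ (a ,
      trans (vertexColour-other (adj-w⇒≢s ab) (adj⇒≢ ab)) (cong edgeIndex (orient-edge ab∈)))
    ... | yes (inj₂ (inj₂ (inj₁ refl))) | _  = inj₁ (s ,
      trans vertexColour-s (cong edgeIndex (orient-edge-swap ab∈)))
    ... | yes (inj₂ (inj₂ (inj₂ refl))) | _  = inj₁ (s ,
      trans vertexColour-s (cong edgeIndex (orient-edge ab∈)))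

    all-used : UsesAllColors colouring
    all-used j = subst Used (edgeIndex-lookup j) (edgeIndex-used (∈-lookup j))

    tmcColouring : Σ (TotalColoring G (edgeCount G)) λ c → IsTMC c × UsesAllColors c
    tmcColouring = subst (λ k → Σ (TotalColoring G k) λ c → IsTMC c × UsesAllColors c)
                         length-edges (colouring , tmc , all-used)

  tmc≡edgeCount : ∀ {s z w} → s ≢ w → Adj G s z → ¬ Adj G s w →
                  (∀ {x} → x ≢ s → x ≢ w → Adj G x w) → NoDominatingVertex G →
                  TmcEq G (edgeCount G)
  tmc≡edgeCount {s} {z} {w} s≢w s~z s≁w adj-w no-dom =
    LowerBound.tmcColouring s z w s≢w s~z s≁w adj-w ,
    λ k c tmc all-used → UpperBound.colours≤edgeCount c no-dom tmc all-used

module GntGraph (n p : ℕ) where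

  private
    q : ℕ
    q = n ∸ p ∸ 1

    class : ℕ → ℕ
    class = vclass n p

    sel : ℕ → Bool
    sel = selected n p

  class-low : ∀ {i} → i < 2 * q → class i ≡ i / 2
  class-low i<2q rewrite <⇒<ᵇ≡true i<2q = refl

  class-high : ∀ {i} → ¬ i < 2 * q → class i ≡ q
  class-high i≮2q rewrite ≮⇒<ᵇ≡false i≮2q = refl

  sel-low : ∀ {i} → i < 2 * q → sel i ≡ (i % 2 ≡ᵇ 0)
  sel-low i<2q rewrite <⇒<ᵇ≡true i<2q = refl

  sel-high : ∀ {i} → ¬ i < 2 * q → sel i ≡ (i ≡ᵇ 2 * q)
  sel-high i≮2q rewrite ≮⇒<ᵇ≡false i≮2q = refl

  Gnt-comm : ∀ u v → Gnt n p u v ≡ Gnt n p v u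
  Gnt-comm u v rewrite ≡ᵇ-sym (toℕ u) (toℕ v) | ≡ᵇ-sym (class (toℕ u)) (class (toℕ v))
                     | ∨-comm (sel (toℕ u)) (sel (toℕ v)) = refl

  Gnt-sym : ∀ {u v} → Adj (Gnt n p) u v → Adj (Gnt n p) v u
  Gnt-sym {u} {v} = subst T (Gnt-comm u v)

  Gnt-irrefl : ∀ {u} → ¬ Adj (Gnt n p) u u
  Gnt-irrefl {u} rewrite ≡ᵇ-refl (toℕ u) = λ ()

  Gnt-nonadjacent : ∀ {u v} → class (toℕ u) ≡ class (toℕ v) →
                    sel (toℕ u) ≡ true ⊎ sel (toℕ v) ≡ true → ¬ Adj (Gnt n p) u v
  Gnt-nonadjacent {u} {v} same-class some-selected uv =
    subst T (Equivalence.to T-not-≡ (proj₂ (Equivalence.to T-∧ uv))) conflict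
    where
    conflict : T ((class (toℕ u) ≡ᵇ class (toℕ v)) ∧ (sel (toℕ u) ∨ sel (toℕ v)))
    conflict = Equivalence.from T-∧ (≡⇒≡ᵇ _ _ same-class ,
      Equivalence.from T-∨ (Sum.map (Equivalence.from T-≡) (Equivalence.from T-≡) some-selected))

  Gnt-adjacent-classes : ∀ {u v} → u ≢ v → class (toℕ u) ≢ class (toℕ v) → Adj (Gnt n p) u v
  Gnt-adjacent-classes u≢v classes≢
    rewrite ≢⇒≡ᵇ≡false (u≢v ∘ toℕ-injective) | ≢⇒≡ᵇ≡false classes≢ = _

  Gnt-adjacent-unselected : ∀ {u v} → u ≢ v → sel (toℕ u) ≡ false → sel (toℕ v) ≡ false →
                            Adj (Gnt n p) u v
  Gnt-adjacent-unselected {u} {v} u≢v u-unsel v-unsel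
    rewrite ≢⇒≡ᵇ≡false (u≢v ∘ toℕ-injective) | u-unsel | v-unsel
          | ∧-zeroʳ (class (toℕ u) ≡ᵇ class (toℕ v)) = _

  parity : ∀ i → i ≡ i / 2 * 2 ⊎ i ≡ 1 + i / 2 * 2
  parity i with i % 2 | m%n<n i 2 | m≡m%n+[m/n]*n i 2
  ... | 0           | _                | i≡ = inj₁ i≡
  ... | 1           | _                | i≡ = inj₂ i≡
  ... | suc (suc _) | s≤s (s≤s ())     | _

  half<q : ∀ {i} → i < 2 * q → i / 2 < q
  half<q {i} i<2q = m<n*o⇒m/o<n (subst (i <_) (*-comm 2 q) i<2q)

  odd<2q : ∀ {k} → k < q → 1 + k * 2 < 2 * q
  odd<2q {k} k<q = subst (2 + k * 2 ≤_) (*-comm q 2) (*-monoˡ-≤ 2 k<q)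

  even<2q : ∀ {k} → k < q → k * 2 < 2 * q
  even<2q k<q = <-trans (n<1+n _) (odd<2q k<q)

  class-mates-nonadjacent : ∀ {k u v} → k < q → toℕ u ≡ k * 2 → toℕ v ≡ 1 + k * 2 →
                            ¬ Adj (Gnt n p) u v
  class-mates-nonadjacent {k} {u} {v} k<q u≡2k v≡2k+1 = Gnt-nonadjacent
    (begin
      class (toℕ u)     ≡⟨ cong class u≡2k ⟩
      class (k * 2)     ≡⟨ class-low (even<2q k<q) ⟩
      k * 2 / 2         ≡⟨ m*n/n≡m k 2 ⟩
      k                 ≡⟨ sym (m*n/n≡m k 2) ⟩
      1 / 2 + k * 2 / 2 ≡⟨ sym (+-distrib-/-∣ʳ 1 {d = 2} (divides k refl)) ⟩
      (1 + k * 2) / 2   ≡⟨ sym (class-low (odd<2q k<q)) ⟩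
      class (1 + k * 2) ≡⟨ cong class (sym v≡2k+1) ⟩
      class (toℕ v)     ∎)
    (inj₁ (trans (cong sel u≡2k)
          (trans (sel-low (even<2q k<q)) (cong (_≡ᵇ 0) (m*n%n≡0 k 2)))))
    where open ≡-Reasoning

  module Configuration (n<2p : n < 2 * p) (p+2<n : p + 2 < n) where

    1+q+p≡n : suc q + p ≡ n
    1+q+p≡n = begin
      suc (q + p)       ≡⟨ sym (+-suc q p) ⟩
      q + suc p         ≡⟨ cong (_+ suc p) (trans (∸-+-assoc n p 1) (cong (n ∸_) (+-comm p 1))) ⟩
      n ∸ suc p + suc p ≡⟨ m∸n+n≡m (ℕ.≤-trans (s≤s (ℕ.m≤m+n p 2)) p+2<n) ⟩
      n                 ∎
      where open ≡-Reasoning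

    2≤q : 2 ≤ q
    2≤q = +-cancelʳ-≤ p 2 q (ℕ.s≤s⁻¹ (subst (3 + p ≤_) (sym 1+q+p≡n)
                                         (subst (λ k → suc k ≤ n) (+-comm p 2) p+2<n)))

    1+q<p : suc q < p
    1+q<p = +-cancelʳ-< p (suc q) p
      (subst₂ _<_ (sym 1+q+p≡n) (cong (p +_) (+-identityʳ p)) n<2p)

    2q+1<n : 1 + 2 * q < n
    2q+1<n = begin
      suc (suc (q + (q + 0))) ≡⟨ cong (λ k → suc (suc (q + k))) (+-identityʳ q) ⟩
      suc (suc (q + q))       ≡⟨ cong suc (sym (+-suc q q)) ⟩
      suc (q + suc q)         ≤⟨ s≤s (+-monoʳ-≤ q (<⇒≤ 1+q<p)) ⟩
      suc q + p               ≡⟨ 1+q+p≡n ⟩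
      n                       ∎
      where open ≤-Reasoning

    s<n : 2 * q < n
    s<n = <-trans (n<1+n _) 2q+1<n

    1<2q : 1 < 2 * q
    1<2q = ℕ.≤-trans 2≤q (ℕ.m≤m+n q (q + 0))

    s z w : Fin n
    s = fromℕ< s<n
    z = fromℕ< (<-trans 1<2q s<n)
    w = fromℕ< 2q+1<n

    toℕ-s : toℕ s ≡ 2 * q
    toℕ-s = toℕ-fromℕ< s<n

    toℕ-z : toℕ z ≡ 1
    toℕ-z = toℕ-fromℕ< (<-trans 1<2q s<n)

    toℕ-w : toℕ w ≡ 1 + 2 * q
    toℕ-w = toℕ-fromℕ< 2q+1<n

    class-s : class (toℕ s) ≡ q
    class-s = trans (cong class toℕ-s) (class-high (ℕ.n≮n _))

    sel-s : sel (toℕ s) ≡ true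
    sel-s = trans (cong sel toℕ-s) (trans (sel-high (ℕ.n≮n _)) (≡ᵇ-refl (2 * q)))

    class-w : class (toℕ w) ≡ q
    class-w = trans (cong class toℕ-w) (class-high (ℕ.<-asym (n<1+n _)))

    sel-w : sel (toℕ w) ≡ false
    sel-w = trans (cong sel toℕ-w) (trans (sel-high (ℕ.<-asym (n<1+n _))) (≢⇒≡ᵇ≡false (ℕ.1+n≢n {2 * q})))

    class-z : class (toℕ z) ≡ 0
    class-z = trans (cong class toℕ-z) (class-low 1<2q)

    s≢w : s ≢ w
    s≢w s≡w = ℕ.1+n≢n (trans (sym toℕ-w) (trans (cong toℕ (sym s≡w)) toℕ-s))

    s~z : Adj (Gnt n p) s z
    s~z = Gnt-adjacent-classes s≢z (λ eq → q≢0 (trans (sym class-s) (trans eq class-z)))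
      where
      s≢z : s ≢ z
      s≢z s≡z = ℕ.<⇒≢ 1<2q (trans (sym toℕ-z) (trans (cong toℕ (sym s≡z)) toℕ-s))
      q≢0 : q ≢ 0
      q≢0 = ≢-sym (ℕ.<⇒≢ (ℕ.≤-trans (s≤s z≤n) 2≤q))

    s≁w : ¬ Adj (Gnt n p) s w
    s≁w = Gnt-nonadjacent (trans class-s (sym class-w)) (inj₁ sel-s)

    adj-w : ∀ {x} → x ≢ s → x ≢ w → Adj (Gnt n p) x w
    adj-w {x} x≢s x≢w with toℕ x ℕ.<? 2 * q
    ... | yes low = Gnt-adjacent-classes x≢w
      (λ eq → ℕ.<⇒≢ (half<q low) (trans (sym (class-low low)) (trans eq class-w)))
    ... | no high = Gnt-adjacent-unselected x≢w
      (trans (sel-high high) (≢⇒≡ᵇ≡false (λ eq → x≢s (toℕ-injective (trans eq (sym toℕ-s)))))) sel-w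

    class-mate : ∀ {x} → toℕ x < 2 * q → ∃[ v ] (x ≢ v × ¬ Adj (Gnt n p) x v)
    class-mate {x} low with parity (toℕ x)
    ... | inj₁ x≡2k = fromℕ< (<-trans (odd<2q (half<q low)) s<n) ,
      (λ x≡v → ℕ.1+n≢n (trans (sym (toℕ-fromℕ< _)) (trans (cong toℕ (sym x≡v)) x≡2k))) ,
      class-mates-nonadjacent (half<q low) x≡2k (toℕ-fromℕ< _)
    ... | inj₂ x≡2k+1 = fromℕ< (<-trans (even<2q (half<q low)) s<n) ,
      (λ x≡v → ℕ.1+n≢n (trans (sym x≡2k+1) (trans (cong toℕ x≡v) (toℕ-fromℕ< _)))) ,
      (λ xv → class-mates-nonadjacent (half<q low) (toℕ-fromℕ< _) x≡2k+1 (Gnt-sym xv))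

    noDominatingVertex : NoDominatingVertex (Gnt n p)
    noDominatingVertex x with toℕ x ℕ.<? 2 * q | x Fin.≟ s
    ... | yes low  | _        = class-mate low
    ... | no  _    | yes refl = w , s≢w , s≁w
    ... | no  high | no  x≢s  = s , x≢s , λ xs →
      Gnt-nonadjacent (trans class-s (sym (class-high high))) (inj₁ sel-s) (Gnt-sym xs)

lemma5 : (n p : ℕ) → n < 2 * p → p + 2 < n →
    TmcEq (Gnt n p) (edgeCount (Gnt n p))
lemma5 n p n<2p p+2<n = tmc≡edgeCount s≢w s~z s≁w adj-w noDominatingVertex
  where
  open GntGraph n p
  open Configuration n<2p p+2<n
  open SimpleGraph (Gnt n p) Gnt-sym Gnt-irrefl
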